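{- Fix a square-free integer $D\ge 2$ and let $d_r=1+u_D^r+u_D^{ -r}$ for $r=1,2,3,\dots$ (these are positive integers). Then the sequence $d_1,d_2,\dots$ contains infinitely many distinct infinite subsequences $d_{k_1},d_{k_2},\dots$ (with $k_1<k_2<\cdots$) such that $d_{k_1}\mid d_{k_2}\mid d_{k_3}\mid\cdots$.
   Context: Let $K=\mathbb{Q}(\sqrt D)$, fix the real embedding sending $\sqrt D$ to the positive square root of $D$, let $u_f$ be the fundamental unit of $\mathbb{Z}_K$ which is $>1$ under this embedding, and set $u_D=u_f^2$ if $u_f$ has norm $-1$ and $u_D=u_f$ otherwise. -}

module Defs where

open import Data.Nat as ℕ using (ℕ; zero; suc)
open import Data.Integer as ℤ using (ℤ)
open import Data.Rational as ℚ using (ℚ; 0ℚ; 1ℚ; _/_)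
open import Data.Nat.Divisibility using (_∣_)
open import Data.Product using (Σ; ∃; _×_; _,_)
open import Data.Sum using (_⊎_)
open import Relation.Binary.PropositionalEquality using (_≡_; _≢_)
open import Relation.Nullary using (yes; no)

SquareFree : ℕ → Set
SquareFree n = ∀ (p : ℕ) → (p ℕ.* p) ∣ n → p ≡ 1

-- Elements a + b√D of K = ℚ(√D), with a b : ℚ (D is a parameter).
record K : Set where
  constructor _+√D·_
  field
    re : ℚ
    im : ℚ
open K public

ℤ→ℚ : ℤ → ℚ
ℤ→ℚ m = m / 1

IsIntegerℚ : ℚ → Set
IsIntegerℚ q = Σ ℤ λ m → q ≡ ℤ→ℚ m

module Field (D : ℕ) where
  Dℚ : ℚ
  Dℚ = ℤ.+ D / 1

  fromℤ : ℤ → K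
  fromℤ m = ℤ→ℚ m +√D· 0ℚ

  0K 1K : K
  0K = 0ℚ +√D· 0ℚ
  1K = 1ℚ +√D· 0ℚ

  _+K_ : K → K → K
  (a +√D· b) +K (c +√D· d) = (a ℚ.+ c) +√D· (b ℚ.+ d)

  _-K_ : K → K → K
  (a +√D· b) -K (c +√D· d) = (a ℚ.- c) +√D· (b ℚ.- d)

  _*K_ : K → K → K
  (a +√D· b) *K (c +√D· d) =
    ((a ℚ.* c) ℚ.+ (Dℚ ℚ.* (b ℚ.* d))) +√D· ((a ℚ.* d) ℚ.+ (b ℚ.* c))

  conj : K → K
  conj (a +√D· b) = a +√D· (ℚ.- b)

  norm : K → ℚ
  norm (a +√D· b) = (a ℚ.* a) ℚ.- (Dℚ ℚ.* (b ℚ.* b))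

  trace : K → ℚ
  trace (a +√D· b) = a ℚ.+ a

  -- multiplicative inverse x⁻¹ = conj x / N(x)  (set to 0 at 0)
  invK : K → K
  invK x with norm x ℚ.≟ 0ℚ
  ... | yes _ = 0K
  ... | no n≢0 = let instance _ = ℚ.≢-nonZero n≢0 in
                 (re (conj x) ℚ.* (1ℚ ℚ.÷ norm x)) +√D· (im (conj x) ℚ.* (1ℚ ℚ.÷ norm x))

  _^K_ : K → ℕ → K
  x ^K zero = 1K
  x ^K suc n = x *K (x ^K n)

  -- algebraic integer of K: trace and norm are rational integers
  -- (i.e. the minimal polynomial is monic with integer coefficients)
  IsIntegral : K → Set
  IsIntegral x = IsIntegerℚ (trace x) × IsIntegerℚ (norm x)

  IsUnit : K → Set
  IsUnit x = IsIntegral x × Σ K (λ y → IsIntegral y × (x *K y ≡ 1K))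

  -- positivity under the real embedding √D ↦ +√D
  IsPositive : K → Set
  IsPositive (a +√D· b) =
      (0ℚ ℚ.< a × 0ℚ ℚ.≤ b)
    ⊎ (0ℚ ℚ.≤ a × 0ℚ ℚ.< b)
    ⊎ (0ℚ ℚ.< a × b ℚ.< 0ℚ × (Dℚ ℚ.* (b ℚ.* b)) ℚ.< (a ℚ.* a))
    ⊎ (a ℚ.< 0ℚ × 0ℚ ℚ.< b × (a ℚ.* a) ℚ.< (Dℚ ℚ.* (b ℚ.* b)))

  _>K_ : K → K → Set
  x >K y = IsPositive (x -K y)

  IsFundamentalUnit : K → Set
  IsFundamentalUnit ε =
    IsUnit ε × (ε >K 1K) ×
    (∀ (η : K) → IsUnit η → η >K 1K → Σ ℕ λ n → (1 ℕ.≤ n) × (η ≡ ε ^K n))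

  uD : K → K
  uD uf with norm uf ℚ.≟ ℚ.- 1ℚ
  ... | yes _ = uf *K uf
  ... | no _ = uf

  d : K → ℕ → K
  d uf r = (1K +K (uD uf ^K r)) +K invK (uD uf ^K r)

  _∣ℤ_ : K → K → Set
  x ∣ℤ y = Σ ℤ λ m → y ≡ fromℤ m *K x

-- With u = u_D we have N(u) = 1, so u^r + u^(-r) is the trace t_r of u^r, an integer,
-- and d_r = 1 + t_r.  Squaring gives t_(2r) = t_r² - 2, hence
-- d_(2r) = t_r² - 1 = (t_r - 1) · d_r.  So d_k ∣ d_(2k) ∣ d_(4k) ∣ ⋯ for every k ≥ 1,
-- and the sequences k_i = (j + 1) · 2^i for j = 0, 1, 2, … have pairwise distinct first terms.
module Submission where

open import Defs
open import Data.Nat as ℕ using (ℕ; zero; suc; _≤_; _<_)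
import Data.Nat.Properties as ℕ
open import Data.Nat.Coprimality using (1-coprimeTo) renaming (sym to coprime-sym)
open import Data.Integer as ℤ using (ℤ; +_; -[1+_])
import Data.Integer.Properties as ℤ
open import Data.Rational as ℚ using (ℚ; 0ℚ; 1ℚ; _/_; ↥_)
import Data.Rational.Properties as ℚ
open import Data.Rational.Literals using () renaming (fromℤ to fromℤℚ)
open import Data.Rational.Solver using (module +-*-Solver)
open import Data.Product using (Σ; _×_; _,_; proj₁; proj₂)
open import Data.Sum using (_⊎_; inj₁; inj₂; [_,_]′)
open import Function using (id)
open import Data.Empty using (⊥-elim)
open import Relation.Nullary using (yes; no)
open import Relation.Binary.PropositionalEquality using (_≡_; _≢_; refl; sym; trans; cong; cong₂; subst; module ≡-Reasoning)

open +-*-Solver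

ℤ→ℚ≡fromℤℚ : ∀ m → ℤ→ℚ m ≡ fromℤℚ m
ℤ→ℚ≡fromℤℚ (+ n)    = ℚ.normalize-coprime (coprime-sym (1-coprimeTo n))
ℤ→ℚ≡fromℤℚ -[1+ n ] = cong ℚ.-_ (ℚ.normalize-coprime (coprime-sym (1-coprimeTo (suc n))))

ℤ→ℚ-injective : ∀ {m n} → ℤ→ℚ m ≡ ℤ→ℚ n → m ≡ n
ℤ→ℚ-injective {m} {n} eq = cong ↥_ (trans (sym (ℤ→ℚ≡fromℤℚ m)) (trans eq (ℤ→ℚ≡fromℤℚ n)))

ℤ→ℚ-+ : ∀ m n → ℤ→ℚ (m ℤ.+ n) ≡ ℤ→ℚ m ℚ.+ ℤ→ℚ n
ℤ→ℚ-+ m n = begin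
  (m ℤ.+ n) / 1                  ≡⟨ cong₂ (λ a b → (a ℤ.+ b) / 1) (sym (ℤ.*-identityʳ m)) (sym (ℤ.*-identityʳ n)) ⟩
  (m ℤ.* + 1 ℤ.+ n ℤ.* + 1) / 1  ≡⟨⟩
  fromℤℚ m ℚ.+ fromℤℚ n          ≡⟨ sym (cong₂ ℚ._+_ (ℤ→ℚ≡fromℤℚ m) (ℤ→ℚ≡fromℤℚ n)) ⟩
  ℤ→ℚ m ℚ.+ ℤ→ℚ n                ∎
  where open ≡-Reasoning

ℤ→ℚ-* : ∀ m n → ℤ→ℚ (m ℤ.* n) ≡ ℤ→ℚ m ℚ.* ℤ→ℚ n
ℤ→ℚ-* m n = sym (cong₂ ℚ._*_ (ℤ→ℚ≡fromℤℚ m) (ℤ→ℚ≡fromℤℚ n))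

ℤ→ℚ-neg : ∀ m → ℤ→ℚ (ℤ.- m) ≡ ℚ.- ℤ→ℚ m
ℤ→ℚ-neg m = trans (ℤ→ℚ≡fromℤℚ (ℤ.- m)) (trans (fromℤℚ-neg m) (sym (cong ℚ.-_ (ℤ→ℚ≡fromℤℚ m))))
  where
  fromℤℚ-neg : ∀ m → fromℤℚ (ℤ.- m) ≡ ℚ.- fromℤℚ m
  fromℤℚ-neg (+ zero)  = refl
  fromℤℚ-neg (+ suc n) = refl
  fromℤℚ-neg -[1+ n ]  = refl

ℤ→ℚ-- : ∀ m n → ℤ→ℚ (m ℤ.- n) ≡ ℤ→ℚ m ℚ.- ℤ→ℚ n
ℤ→ℚ-- m n = trans (ℤ→ℚ-+ m (ℤ.- n)) (cong (ℤ→ℚ m ℚ.+_) (ℤ→ℚ-neg n))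

IsIntegerℚ-+ : ∀ {p q} → IsIntegerℚ p → IsIntegerℚ q → IsIntegerℚ (p ℚ.+ q)
IsIntegerℚ-+ (m , refl) (n , refl) = m ℤ.+ n , sym (ℤ→ℚ-+ m n)

IsIntegerℚ-- : ∀ {p q} → IsIntegerℚ p → IsIntegerℚ q → IsIntegerℚ (p ℚ.- q)
IsIntegerℚ-- (m , refl) (n , refl) = m ℤ.- n , sym (ℤ→ℚ-- m n)

IsIntegerℚ-* : ∀ {p q} → IsIntegerℚ p → IsIntegerℚ q → IsIntegerℚ (p ℚ.* q)
IsIntegerℚ-* (m , refl) (n , refl) = m ℤ.* n , sym (ℤ→ℚ-* m n)

m*n≡1⇒m≡±1 : ∀ m n → m ℤ.* n ≡ + 1 → m ≡ + 1 ⊎ m ≡ -[1+ 0 ]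
m*n≡1⇒m≡±1 m n mn≡1 with ℕ.m*n≡1⇒m≡1 ℤ.∣ m ∣ ℤ.∣ n ∣ (trans (sym (ℤ.abs-* m n)) (cong ℤ.∣_∣ mn≡1))
m*n≡1⇒m≡±1 (+ 1)    n _ | refl = inj₁ refl
m*n≡1⇒m≡±1 -[1+ 0 ] n _ | refl = inj₂ refl

module QuadraticField (D : ℕ) where
  open Field D

  ≡-+√D· : ∀ {a b c e} → a ≡ c → b ≡ e → (a +√D· b) ≡ (c +√D· e)
  ≡-+√D· = cong₂ _+√D·_

  *K-assoc : ∀ x y z → (x *K y) *K z ≡ x *K (y *K z)
  *K-assoc (a +√D· b) (c +√D· e) (f +√D· g) = ≡-+√D·
    (solve 7 (λ a b c e f g δ →
       (a :* c :+ δ :* (b :* e)) :* f :+ δ :* ((a :* e :+ b :* c) :* g)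
       := a :* (c :* f :+ δ :* (e :* g)) :+ δ :* (b :* (c :* g :+ e :* f))) refl a b c e f g Dℚ)
    (solve 7 (λ a b c e f g δ →
       (a :* c :+ δ :* (b :* e)) :* g :+ (a :* e :+ b :* c) :* f
       := a :* (c :* g :+ e :* f) :+ b :* (c :* f :+ δ :* (e :* g))) refl a b c e f g Dℚ)

  *K-identityˡ : ∀ x → 1K *K x ≡ x
  *K-identityˡ (a +√D· b) = ≡-+√D·
    (solve 3 (λ a b δ → con 1ℚ :* a :+ δ :* (con 0ℚ :* b) := a) refl a b Dℚ)
    (solve 2 (λ a b → con 1ℚ :* b :+ con 0ℚ :* a := b) refl a b)

  *K-identityʳ : ∀ x → x *K 1K ≡ x
  *K-identityʳ (a +√D· b) = ≡-+√D·
    (solve 3 (λ a b δ → a :* con 1ℚ :+ δ :* (b :* con 0ℚ) := a) refl a b Dℚ)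
    (solve 2 (λ a b → a :* con 0ℚ :+ b :* con 1ℚ := b) refl a b)

  ^K-+ : ∀ x m n → x ^K (m ℕ.+ n) ≡ (x ^K m) *K (x ^K n)
  ^K-+ x zero    n = sym (*K-identityˡ _)
  ^K-+ x (suc m) n = trans (cong (x *K_) (^K-+ x m n)) (sym (*K-assoc x _ _))

  fromℤ-*K : ∀ m q → fromℤ m *K (q +√D· 0ℚ) ≡ (ℤ→ℚ m ℚ.* q) +√D· 0ℚ
  fromℤ-*K m q = ≡-+√D·
    (solve 3 (λ a q δ → a :* q :+ δ :* (con 0ℚ :* con 0ℚ) := a :* q) refl (ℤ→ℚ m) q Dℚ)
    (solve 2 (λ a q → a :* con 0ℚ :+ con 0ℚ :* q := con 0ℚ) refl (ℤ→ℚ m) q)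

  norm-1K : norm 1K ≡ 1ℚ
  norm-1K = solve 1 (λ δ → con 1ℚ :* con 1ℚ :- δ :* (con 0ℚ :* con 0ℚ) := con 1ℚ) refl Dℚ

  norm-*K : ∀ x y → norm (x *K y) ≡ norm x ℚ.* norm y
  norm-*K (a +√D· b) (c +√D· e) = solve 5 (λ a b c e δ →
    (a :* c :+ δ :* (b :* e)) :* (a :* c :+ δ :* (b :* e)) :- δ :* ((a :* e :+ b :* c) :* (a :* e :+ b :* c))
    := (a :* a :- δ :* (b :* b)) :* (c :* c :- δ :* (e :* e))) refl a b c e Dℚ

  norm-^K : ∀ x → norm x ≡ 1ℚ → ∀ n → norm (x ^K n) ≡ 1ℚ
  norm-^K x nx≡1 zero    = norm-1K
  norm-^K x nx≡1 (suc n) = trans (norm-*K x _) (cong₂ ℚ._*_ nx≡1 (norm-^K x nx≡1 n))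

  -- Cayley–Hamilton: x² = Tr(x) x - N(x).
  trace-*K-*K : ∀ x y → trace (x *K (x *K y)) ≡ trace x ℚ.* trace (x *K y) ℚ.- norm x ℚ.* trace y
  trace-*K-*K (a +√D· b) (c +√D· e) = solve 5 (λ a b c e δ →
    let p = a :* c :+ δ :* (b :* e) ; q = a :* e :+ b :* c ; r = a :* p :+ δ :* (b :* q)
    in r :+ r := (a :+ a) :* (p :+ p) :- (a :* a :- δ :* (b :* b)) :* (c :+ c)) refl a b c e Dℚ

  trace-square : ∀ x → trace (x *K x) ≡ trace x ℚ.* trace x ℚ.- (norm x ℚ.+ norm x)
  trace-square (a +√D· b) = solve 3 (λ a b δ →
    let r = a :* a :+ δ :* (b :* b) ; n = a :* a :- δ :* (b :* b)
    in r :+ r := (a :+ a) :* (a :+ a) :- (n :+ n)) refl a b Dℚ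

  ^K-integral : ∀ x → IsIntegral x → ∀ n → IsIntegral (x ^K n)
  ^K-integral x (tx , nx) n = proj₁ (traces n) , norms n
    where
    norms : ∀ n → IsIntegerℚ (norm (x ^K n))
    norms zero    = + 1 , norm-1K
    norms (suc n) = subst IsIntegerℚ (sym (norm-*K x _)) (IsIntegerℚ-* nx (norms n))

    traces : ∀ n → IsIntegerℚ (trace (x ^K n)) × IsIntegerℚ (trace (x ^K suc n))
    traces zero    = (+ 2 , refl) , subst IsIntegerℚ (cong trace (sym (*K-identityʳ x))) tx
    traces (suc n) = let (tₙ , tₙ₊₁) = traces n in
      tₙ₊₁ , subst IsIntegerℚ (sym (trace-*K-*K x (x ^K n)))
                   (IsIntegerℚ-- (IsIntegerℚ-* tx tₙ₊₁) (IsIntegerℚ-* nx tₙ))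

  IsUnit⇒norm≡±1 : ∀ x → IsUnit x → norm x ≡ 1ℚ ⊎ norm x ≡ ℚ.- 1ℚ
  IsUnit⇒norm≡±1 x ((_ , m , Nx≡m) , y , (_ , n , Ny≡n) , xy≡1) = ±1 (m*n≡1⇒m≡±1 m n mn≡1)
    where
    open ≡-Reasoning
    mn≡1 : m ℤ.* n ≡ + 1
    mn≡1 = ℤ→ℚ-injective (begin
      ℤ→ℚ (m ℤ.* n)       ≡⟨ ℤ→ℚ-* m n ⟩
      ℤ→ℚ m ℚ.* ℤ→ℚ n     ≡⟨ sym (cong₂ ℚ._*_ Nx≡m Ny≡n) ⟩
      norm x ℚ.* norm y   ≡⟨ sym (norm-*K x y) ⟩
      norm (x *K y)       ≡⟨ cong norm xy≡1 ⟩
      norm 1K             ≡⟨ norm-1K ⟩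
      1ℚ                  ∎)
    ±1 : m ≡ + 1 ⊎ m ≡ -[1+ 0 ] → norm x ≡ 1ℚ ⊎ norm x ≡ ℚ.- 1ℚ
    ±1 (inj₁ refl) = inj₁ Nx≡m
    ±1 (inj₂ refl) = inj₂ Nx≡m

  uD-cases : ∀ uf → norm uf ≡ ℚ.- 1ℚ × uD uf ≡ uf *K uf ⊎ norm uf ≢ ℚ.- 1ℚ × uD uf ≡ uf
  uD-cases uf with norm uf ℚ.≟ ℚ.- 1ℚ
  ... | yes N≡-1 = inj₁ (N≡-1 , refl)
  ... | no  N≢-1 = inj₂ (N≢-1 , refl)

  -1*-1≡1 : ℚ.- 1ℚ ℚ.* ℚ.- 1ℚ ≡ 1ℚ
  -1*-1≡1 = refl

  norm-uD : ∀ uf → IsUnit uf → norm (uD uf) ≡ 1ℚ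
  norm-uD uf uf-unit = [ squared , unchanged ]′ (uD-cases uf)
    where
    squared : norm uf ≡ ℚ.- 1ℚ × uD uf ≡ uf *K uf → norm (uD uf) ≡ 1ℚ
    squared (N≡-1 , u≡uf²) =
      trans (cong norm u≡uf²) (trans (norm-*K uf uf) (trans (cong₂ ℚ._*_ N≡-1 N≡-1) -1*-1≡1))
    unchanged : norm uf ≢ ℚ.- 1ℚ × uD uf ≡ uf → norm (uD uf) ≡ 1ℚ
    unchanged (N≢-1 , u≡uf) = trans (cong norm u≡uf)
      ([ id , (λ N≡-1 → ⊥-elim (N≢-1 N≡-1)) ]′ (IsUnit⇒norm≡±1 uf uf-unit))

  uD-integral : ∀ uf → IsIntegral uf → IsIntegral (uD uf)
  uD-integral uf uf-integral = [ squared , unchanged ]′ (uD-cases uf)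
    where
    squared : norm uf ≡ ℚ.- 1ℚ × uD uf ≡ uf *K uf → IsIntegral (uD uf)
    squared (_ , u≡uf²) =
      subst IsIntegral (trans (cong (uf *K_) (*K-identityʳ uf)) (sym u≡uf²)) (^K-integral uf uf-integral 2)
    unchanged : norm uf ≢ ℚ.- 1ℚ × uD uf ≡ uf → IsIntegral (uD uf)
    unchanged (_ , u≡uf) = subst IsIntegral (sym u≡uf) uf-integral

  invK-norm1 : ∀ x → norm x ≡ 1ℚ → invK x ≡ conj x
  invK-norm1 x Nx≡1 with norm x ℚ.≟ 0ℚ
  ... | yes Nx≡0 = ⊥-elim (1≢0 (trans (sym Nx≡1) Nx≡0))
    where
    1≢0 : 1ℚ ≢ 0ℚ
    1≢0 ()
  ... | no Nx≢0 = ≡-+√D· (scaled-by-1 (re (conj x))) (scaled-by-1 (im (conj x)))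
    where
    instance _ = ℚ.≢-nonZero Nx≢0
    ÷1 : ∀ q → q ≡ 1ℚ → .{{_ : ℚ.NonZero q}} → 1ℚ ℚ.÷ q ≡ 1ℚ
    ÷1 q refl = refl
    scaled-by-1 : ∀ a → a ℚ.* (1ℚ ℚ.÷ norm x) ≡ a
    scaled-by-1 a = trans (cong (a ℚ.*_) (÷1 (norm x) Nx≡1)) (ℚ.*-identityʳ a)

  dK : K → K
  dK x = (1K +K x) +K invK x

  dK-norm1 : ∀ x → norm x ≡ 1ℚ → dK x ≡ (1ℚ ℚ.+ trace x) +√D· 0ℚ
  dK-norm1 x Nx≡1 = trans (cong ((1K +K x) +K_) (invK-norm1 x Nx≡1)) (1+x+conj-x x)
    where
    1+x+conj-x : ∀ x → (1K +K x) +K conj x ≡ (1ℚ ℚ.+ trace x) +√D· 0ℚ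
    1+x+conj-x (a +√D· b) = ≡-+√D·
      (solve 1 (λ a → (con 1ℚ :+ a) :+ a := con 1ℚ :+ (a :+ a)) refl a)
      (solve 1 (λ b → (con 0ℚ :+ b) :+ (:- b) := con 0ℚ) refl b)

  dK-square : ∀ x t → norm x ≡ 1ℚ → trace x ≡ ℤ→ℚ t → dK (x *K x) ≡ fromℤ (t ℤ.- + 1) *K dK x
  dK-square x t Nx≡1 Tx≡t = begin
    dK (x *K x)                                   ≡⟨ dK-norm1 (x *K x) Nxx≡1 ⟩
    (1ℚ ℚ.+ trace (x *K x)) +√D· 0ℚ               ≡⟨ cong (λ q → (1ℚ ℚ.+ q) +√D· 0ℚ) (trace-square x) ⟩
    (1ℚ ℚ.+ (T ℚ.* T ℚ.- (N ℚ.+ N))) +√D· 0ℚ      ≡⟨ cong₂ (λ T N → (1ℚ ℚ.+ (T ℚ.* T ℚ.- (N ℚ.+ N))) +√D· 0ℚ) Tx≡t Nx≡1 ⟩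
    (1ℚ ℚ.+ (τ ℚ.* τ ℚ.- (1ℚ ℚ.+ 1ℚ))) +√D· 0ℚ    ≡⟨ cong (_+√D· 0ℚ) (difference-of-squares τ) ⟩
    ((τ ℚ.- 1ℚ) ℚ.* (1ℚ ℚ.+ τ)) +√D· 0ℚ           ≡⟨ cong (λ q → (q ℚ.* (1ℚ ℚ.+ τ)) +√D· 0ℚ) (sym (ℤ→ℚ-- t (+ 1))) ⟩
    (ℤ→ℚ (t ℤ.- + 1) ℚ.* (1ℚ ℚ.+ τ)) +√D· 0ℚ      ≡⟨ sym (fromℤ-*K (t ℤ.- + 1) (1ℚ ℚ.+ τ)) ⟩
    fromℤ (t ℤ.- + 1) *K ((1ℚ ℚ.+ τ) +√D· 0ℚ)     ≡⟨ cong (λ q → fromℤ (t ℤ.- + 1) *K ((1ℚ ℚ.+ q) +√D· 0ℚ)) (sym Tx≡t) ⟩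
    fromℤ (t ℤ.- + 1) *K ((1ℚ ℚ.+ T) +√D· 0ℚ)     ≡⟨ cong (fromℤ (t ℤ.- + 1) *K_) (sym (dK-norm1 x Nx≡1)) ⟩
    fromℤ (t ℤ.- + 1) *K dK x                     ∎
    where
    open ≡-Reasoning
    T = trace x
    N = norm x
    τ = ℤ→ℚ t
    Nxx≡1 : norm (x *K x) ≡ 1ℚ
    Nxx≡1 = trans (norm-*K x x) (cong₂ ℚ._*_ Nx≡1 Nx≡1)
    difference-of-squares : ∀ τ → 1ℚ ℚ.+ (τ ℚ.* τ ℚ.- (1ℚ ℚ.+ 1ℚ)) ≡ (τ ℚ.- 1ℚ) ℚ.* (1ℚ ℚ.+ τ)
    difference-of-squares = solve 1 (λ τ →
      con 1ℚ :+ (τ :* τ :- (con 1ℚ :+ con 1ℚ)) := (τ :- con 1ℚ) :* (con 1ℚ :+ τ)) refl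

  d∣ℤd-double : ∀ uf → IsUnit uf → ∀ r → d uf r ∣ℤ d uf (r ℕ.+ r)
  d∣ℤd-double uf uf-unit r = t ℤ.- + 1 , (begin
    dK (u ^K (r ℕ.+ r))           ≡⟨ cong dK (^K-+ u r r) ⟩
    dK ((u ^K r) *K (u ^K r))     ≡⟨ dK-square (u ^K r) t (norm-^K u (norm-uD uf uf-unit) r) Tuʳ≡t ⟩
    fromℤ (t ℤ.- + 1) *K dK (u ^K r) ∎)
    where
    open ≡-Reasoning
    u = uD uf
    Tuʳ-integer : IsIntegerℚ (trace (u ^K r))
    Tuʳ-integer = proj₁ (^K-integral u (uD-integral uf (proj₁ uf-unit)) r)
    t = proj₁ Tuʳ-integer
    Tuʳ≡t = proj₂ Tuʳ-integer

doubling : ℕ → ℕ → ℕ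
doubling j i = suc j ℕ.* 2 ℕ.^ i

doubling-suc : ∀ j i → doubling j (suc i) ≡ doubling j i ℕ.+ doubling j i
doubling-suc j i = trans (cong (suc j ℕ.*_) (cong (2 ℕ.^ i ℕ.+_) (ℕ.+-identityʳ _)))
                         (ℕ.*-distribˡ-+ (suc j) (2 ℕ.^ i) (2 ℕ.^ i))

doubling-positive : ∀ j i → 1 ≤ doubling j i
doubling-positive j i = ℕ.*-mono-≤ {1} {suc j} (ℕ.s≤s ℕ.z≤n) (ℕ.m^n>0 2 i)

doubling-< : ∀ j i → doubling j i < doubling j (suc i)
doubling-< j i = subst (doubling j i <_) (sym (doubling-suc j i)) (ℕ.m<m+n _ (doubling-positive j i))

doubling-injective : ∀ {j j′} → doubling j 0 ≡ doubling j′ 0 → j ≡ j′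
doubling-injective {j} {j′} eq =
  ℕ.suc-injective (trans (sym (ℕ.*-identityʳ (suc j))) (trans eq (ℕ.*-identityʳ (suc j′))))

proposition2 : (D : ℕ) → 2 ≤ D → SquareFree D →
    (uf : K) → Field.IsFundamentalUnit D uf →
    Σ (ℕ → ℕ → ℕ) λ S →
      (∀ (j : ℕ) → (1 ≤ S j 0)
         × (∀ (i : ℕ) → S j i < S j (suc i))
         × (∀ (i : ℕ) → Field._∣ℤ_ D (Field.d D uf (S j i)) (Field.d D uf (S j (suc i)))))
      × (∀ (j j′ : ℕ) → j ≢ j′ → Σ ℕ λ i → S j i ≢ S j′ i)
proposition2 D _ _ uf (uf-unit , _) = doubling ,
  (λ j → doubling-positive j 0 , doubling-< j , d∣ℤd-next j) ,
  λ j j′ j≢j′ → 0 , λ eq → j≢j′ (doubling-injective eq)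
  where
  open Field D
  open QuadraticField D
  d∣ℤd-next : ∀ j i → d uf (doubling j i) ∣ℤ d uf (doubling j (suc i))
  d∣ℤd-next j i = subst (λ k → d uf (doubling j i) ∣ℤ d uf k) (sym (doubling-suc j i))
                        (d∣ℤd-double uf uf-unit (doubling j i))
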